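{- Let $r\ge1$, let $\mu=(\mu_1,\dots,\mu_r)$ be a tuple of positive integers, $q$ a prime, and $\mathfrak s=(b_1,\dots,b_r)\in\Omega^{\le}(\mu)$. (1) If $\mathfrak s$ is maximal (i.e. $\mathfrak s=\mu$), then $\sum_{\mathfrak t\in\Omega(\mathfrak s)}G_\Delta(\mathfrak t)q^{k_A(\mathfrak t)}=0$. (2) If $\mathfrak s$ is not maximal, then with $i_\Box=i_\Box(\mathfrak s)$, $$\sum_{\mathfrak t\in\Omega(\mathfrak s)}G_\Delta(\mathfrak t)q^{k_A(\mathfrak t)}=q^{k_A(\mathfrak s)-(r-i_\Box)}G_\Delta(\mathfrak s_{i_\Box})\cdot\begin{cases}(1-q^{ -1})^{ -1}&\text{if }b_{i_\Box}>0,\\ 1&\text{if }b_{i_\Box}=0,\end{cases}$$ where $\mathfrak s_{i_\Box}=(b_1,\dots,b_{i_\Box})$ is viewed as an element of $\Omega^{\le}((\mu_1,\dots,\mu_{i_\Box}))$. In particular, if $r=1$, the sum equals $0$ if $\mathfrak s$ is maximal and $q^{k_A(\mathfrak s)}$ otherwise.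
   Context: For a tuple $\nu=(\nu_1,\dots,\nu_n)$ of positive integers, $\Omega^{\le}(\nu)=\{(d_1,\dots,d_n)\in\mathbb Z_{\ge0}^n: d_j\le\nu_j\ \forall j\}$; an element is maximal if it equals $\nu$. For $\mathfrak t=(d_1,\dots,d_n)$, $k_A(\mathfrak t)=\sum_i d_i$. For a non-maximal $\mathfrak s=(b_1,\dots,b_n)\in\Omega^{\le}(\nu)$, $i_\Box(\mathfrak s)=\max\{i: b_i<\nu_i\}$, and $\Omega(\mathfrak s)$ is the set of $(x_1,\dots,x_n)\in\Omega^{\le}(\nu)$ with $x_i=b_i$ for $i<i_\Box(\mathfrak s)$ and $x_i\le b_i$ for $i_\Box(\mathfrak s)\le i\le n$; if $\mathfrak s$ is maximal, $\Omega(\mathfrak s)=\Omega^{\le}(\nu)$. Weights: for a decoration (circled?, boxed?) set $\gamma=1-q^{ -1}$ if neither boxed nor circled, $-q^{ -1}$ if boxed not circled, $1$ if circled not boxed, $0$ if both. For $\mathfrak t=(d_1,\dots,d_n)\in\Omega^{\le}(\nu)$ (a totally resonant short pattern), $G_\Delta(\mathfrak t)$ is the product of $2n-1$ factors $\gamma$: for each $1\le i\le n$ one factor for an entry that is circled iff $d_i=0$ and boxed iff $d_i=\nu_i$; and for each $1\le i\le n-1$ one factor for an entry that is circled iff $d_i=0$ and boxed iff $d_{i+1}=\nu_{i+1}$. (Here $\nu=\mu$ for $G_\Delta(\mathfrak t)$ and $\nu=(\mu_1,\dots,\mu_{i_\Box})$ for $G_\Delta(\mathfrak s_{i_\Box})$.)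 -}

module Defs where

open import Data.Bool using (Bool; true; false; _∧_; if_then_else_)
open import Data.Nat as ℕ using (ℕ; zero; suc; _≡ᵇ_; _<ᵇ_; _≤ᵇ_)
open import Data.Integer as ℤ using (ℤ; +_; -[1+_])
open import Data.Rational using (ℚ; 0ℚ; 1ℚ; _+_; _*_; _-_; 1/_; ≢-nonZero; _/_)
open import Data.Rational.Properties using (_≟_)
open import Data.Fin using (Fin; zero; suc; toℕ)
open import Data.Vec as Vec using (Vec; []; _∷_)
open import Data.List as List using (List; []; _∷_; _++_)
open import Data.Maybe using (Maybe; just; nothing)
open import Relation.Nullary using (yes; no)

fromℕ : ℕ → ℚ
fromℕ n = (+ n) / 1

-- Total multiplicative inverse on ℚ (inv 0 = 0, never used at 0 here).
inv : ℚ → ℚ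
inv p with p ≟ 0ℚ
... | yes _ = 0ℚ
... | no p≢0 = 1/_ p {{≢-nonZero p≢0}}

_^ℕ_ : ℚ → ℕ → ℚ
p ^ℕ zero = 1ℚ
p ^ℕ suc n = p * (p ^ℕ n)

_^ℤ_ : ℚ → ℤ → ℚ
p ^ℤ (+ n) = p ^ℕ n
p ^ℤ -[1+ n ] = inv p ^ℕ suc n

sumℚ : List ℚ → ℚ
sumℚ = List.foldr _+_ 0ℚ

-- Ω^≤(ν): all tuples d with 0 ≤ d_j ≤ ν_j, enumerated (each exactly once).
Ωle : ∀ {n} → Vec ℕ n → List (Vec ℕ n)
Ωle [] = [] ∷ []
Ωle (v ∷ ν) = List.concatMap (λ d → List.map (d ∷_) (Ωle ν)) (List.upTo (suc v))

kA : ∀ {n} → Vec ℕ n → ℕ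
kA = Vec.sum

-- i_□(s) (0-based, as Fin n): the largest index i with b_i < ν_i;
-- nothing iff there is no such index (i.e. s is maximal, for s ∈ Ω^≤(ν)).
iBox : ∀ {n} → Vec ℕ n → Vec ℕ n → Maybe (Fin n)
iBox [] [] = nothing
iBox (b ∷ s) (v ∷ ν) with iBox s ν
... | just i = just (suc i)
... | nothing = if b <ᵇ v then just zero else nothing

allLe : ∀ {n} → Vec ℕ n → Vec ℕ n → Bool
allLe [] [] = true
allLe (x ∷ xs) (b ∷ bs) = (x ≤ᵇ b) ∧ allLe xs bs

agreeBelow : ∀ {n} → Fin n → Vec ℕ n → Vec ℕ n → Bool
agreeBelow zero xs bs = allLe xs bs
agreeBelow (suc i) (x ∷ xs) (b ∷ bs) = (x ≡ᵇ b) ∧ agreeBelow i xs bs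

inΩ : ∀ {n} → Vec ℕ n → Vec ℕ n → Vec ℕ n → Bool
inΩ ν s x with iBox s ν
... | nothing = true
... | just i = agreeBelow i x s

Ω : ∀ {n} → Vec ℕ n → Vec ℕ n → List (Vec ℕ n)
Ω ν s = List.filterᵇ (inΩ ν s) (Ωle ν)

-- weight γ(circled, boxed) with parameter q
γ : ℚ → Bool → Bool → ℚ
γ q false false = 1ℚ - inv q
γ q false true  = 0ℚ - inv q
γ q true  false = 1ℚ
γ q true  true  = 0ℚ

GΔ : ∀ {n} → ℚ → Vec ℕ n → Vec ℕ n → ℚ
GΔ q [] [] = 1ℚ
GΔ q (d ∷ []) (v ∷ []) = γ q (d ≡ᵇ 0) (d ≡ᵇ v)
GΔ q (d ∷ d' ∷ ds) (v ∷ v' ∷ vs) =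
  γ q (d ≡ᵇ 0) (d ≡ᵇ v) * γ q (d ≡ᵇ 0) (d' ≡ᵇ v') * GΔ q (d' ∷ ds) (v' ∷ vs)

-- s_i = (b_1,…,b_{i+1}) for 0-based i (i.e. first i_□ entries)
prefix : ∀ {n} (i : Fin n) → Vec ℕ n → Vec ℕ (suc (toℕ i))
prefix zero (x ∷ xs) = x ∷ []
prefix (suc i) (x ∷ xs) = x ∷ prefix i xs

LHS : ∀ {n} → ℕ → Vec ℕ n → Vec ℕ n → ℚ
LHS q μ s = sumℚ (List.map (λ t → GΔ (fromℕ q) t μ * (fromℕ q ^ℕ kA t)) (Ω μ s))

if0 : ℕ → ℚ → ℚ
if0 zero c = 1ℚ
if0 (suc b) c = c

-- Up to the factor linking it to the boxing of its successor, an entry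
-- d ≤ v of t contributes γ(d = 0, d = v) q^d, so the sums can be evaluated one entry at a time. For
-- v ≥ 1 the entry sum Σ_{d ≤ v} γ(d = 0, d = v) q^d vanishes: the unboxed terms telescope,
-- 1 + (1 − q⁻¹)(q + ⋯ + q^{v−1}) = q^{v−1}, against the boxed top term −q⁻¹ q^v. This gives (1).
-- Preceded by the linking factor of an earlier entry the same sum is q^{v−1}, so a block of free
-- entries contributes q^{Σ (μ_j − 1)}. For non-maximal s, the entries before i_□ are pinned to those
-- of s and factor out together with their G_Δ-factors, entry i_□ runs over 0, …, b_{i_□} < μ_{i_□},
-- never boxed, and contributes q^{b_{i_□}} times its unboxed weight, which (1 − q⁻¹)⁻¹ cancels
-- when b_{i_□} > 0; the entries after i_□ are free.

module Submission where

open import Defs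
open import Data.Nat using (ℕ; suc; _≤_; _<_; _∸_)
open import Data.Nat.Primality using (Prime)
open import Data.Integer as ℤ using (+_)
open import Data.Rational using (ℚ; 0ℚ; 1ℚ; _*_; _-_)
open import Data.Fin using (Fin; toℕ)
open import Data.Vec using (Vec; lookup)
open import Data.Vec.Relation.Unary.All using (All)
open import Data.Vec.Relation.Binary.Pointwise.Inductive using (Pointwise)
open import Data.Maybe using (just)
open import Data.Product using (_×_; ∃)
open import Relation.Nullary using (¬_)
open import Relation.Binary.PropositionalEquality using (_≡_)

open import Algebra.Bundles using (CommutativeMonoid)
open import Data.Bool using (Bool; true; false; T; _∧_; if_then_else_)
open import Data.Bool.Properties using (T-≡)
open import Data.Empty using (⊥-elim)
open import Data.Fin using (zero; suc)
open import Data.Integer.Properties as ℤ using ()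
open import Data.List as List using (List; []; _∷_; _++_; applyUpTo; upTo; concatMap; filterᵇ)
open import Data.List.Properties using (map-++; map-cong; map-∘)
open import Data.Maybe using (nothing)
open import Data.Nat as ℕ using (zero; _≡ᵇ_; _<ᵇ_; _≤ᵇ_; z<s; s<s; s≤s; nonTrivial⇒n>1)
open import Data.Nat.Coprimality as Coprime using (1-coprimeTo)
open import Data.Nat.Primality using (prime⇒nonTrivial)
open import Data.Nat.Properties
  using ( ≡ᵇ⇒≡; <ᵇ⇒<; <⇒<ᵇ; ≤⇒≤ᵇ; ≤ᵇ⇒≤; ≤-pred; ≤∧≮⇒≡; <⇒≢; >⇒≢; ≤-<-trans; <-trans
        ; m<n⇒m<1+n; m≤n+m; m+n∸n≡m; +-suc)
  renaming (+-assoc to +-assoc-ℕ)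
open import Data.Product using (_,_)
open import Data.Rational using (_+_; ↥_; ≢-nonZero)
open import Data.Rational.Properties
  using ( +-identityˡ; +-identityʳ; +-assoc; *-identityˡ; *-identityʳ; *-zeroˡ; *-zeroʳ; *-comm; *-assoc
        ; *-distribˡ-+; *-inverseʳ; *-1-commutativeMonoid; normalize-coprime; _≟_)
open import Data.Rational.Solver using (module +-*-Solver)
open import Data.Sum using (_⊎_; inj₁; inj₂)
open import Data.Unit using (tt)
open import Data.Vec using ([]; _∷_; head)
open import Data.Vec.Relation.Unary.All using ([]; _∷_)
open import Data.Vec.Relation.Binary.Pointwise.Inductive using ([]; _∷_)
open import Function using (_∘_; id; Equivalence)
open import Relation.Binary.PropositionalEquality
  using (_≢_; refl; subst; sym; trans; cong; cong₂; module ≡-Reasoning)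
open import Relation.Nullary using (yes; no)

open import Algebra.Properties.CommutativeSemigroup
  (CommutativeMonoid.commutativeSemigroup *-1-commutativeMonoid) using (interchange)
open +-*-Solver using (solve; _:+_; _:*_; _:-_; _:=_; con)

when : Bool → ℚ → ℚ
when b y = if b then y else 0ℚ

∑< : ℕ → (ℕ → ℚ) → ℚ
∑< zero    f = 0ℚ
∑< (suc n) f = f 0 + ∑< n (f ∘ suc)

infix 5 ∑<
syntax ∑< n (λ d → e) = ∑[ d < n ] e

∑<-cong : ∀ {f g : ℕ → ℚ} n → (∀ d → d < n → f d ≡ g d) → ∑< n f ≡ ∑< n g
∑<-cong zero    f≡g = refl
∑<-cong (suc n) f≡g = cong₂ _+_ (f≡g 0 z<s) (∑<-cong n (λ d d<n → f≡g (suc d) (s<s d<n)))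

∑<-zero : ∀ n → ∑[ d < n ] 0ℚ ≡ 0ℚ
∑<-zero zero    = refl
∑<-zero (suc n) = trans (+-identityˡ _) (∑<-zero n)

∑<-*ˡ : ∀ c f n → ∑[ d < n ] (c * f d) ≡ c * ∑< n f
∑<-*ˡ c f zero    = sym (*-zeroʳ c)
∑<-*ˡ c f (suc n) =
  trans (cong (_+_ (c * f 0)) (∑<-*ˡ c (f ∘ suc) n)) (sym (*-distribˡ-+ c (f 0) _))

∑<-*ʳ : ∀ f c n → ∑[ d < n ] (f d * c) ≡ ∑< n f * c
∑<-*ʳ f c n = trans (∑<-cong n (λ d _ → *-comm (f d) c)) (trans (∑<-*ˡ c f n) (*-comm c _))

∑<-snoc : ∀ f n → ∑< (suc n) f ≡ ∑< n f + f n
∑<-snoc f zero    = trans (+-identityʳ (f 0)) (sym (+-identityˡ (f 0)))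
∑<-snoc f (suc n) =
  trans (cong (_+_ (f 0)) (∑<-snoc (f ∘ suc) n)) (sym (+-assoc (f 0) _ (f (suc n))))

≡ᵇ-refl : ∀ n → (n ≡ᵇ n) ≡ true
≡ᵇ-refl zero    = refl
≡ᵇ-refl (suc n) = ≡ᵇ-refl n

≢⇒≡ᵇ-false : ∀ {m n} → m ≢ n → (m ≡ᵇ n) ≡ false
≢⇒≡ᵇ-false {m} {n} m≢n with m ≡ᵇ n in m≡ᵇn
... | false = refl
... | true  = ⊥-elim (m≢n (≡ᵇ⇒≡ m n (Equivalence.from T-≡ m≡ᵇn)))

<ᵇ-irrefl : ∀ n → (n <ᵇ n) ≡ false
<ᵇ-irrefl zero    = refl
<ᵇ-irrefl (suc n) = <ᵇ-irrefl n

∧-trueˡ : ∀ {x y} → (x ∧ y) ≡ true → T x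
∧-trueˡ {true} _ = tt

suc-≤ᵇ-suc : ∀ m n → (suc m ≤ᵇ suc n) ≡ (m ≤ᵇ n)
suc-≤ᵇ-suc zero    n = refl
suc-≤ᵇ-suc (suc m) n = refl

∑<-split-last : ∀ (F : Bool → ℕ → ℚ) n →
  ∑[ d < suc n ] F (d ≡ᵇ n) d ≡ (∑[ d < n ] F false d) + F true n
∑<-split-last F n = begin
  ∑[ d < suc n ] F (d ≡ᵇ n) d             ≡⟨ ∑<-snoc (λ d → F (d ≡ᵇ n) d) n ⟩
  (∑[ d < n ] F (d ≡ᵇ n) d) + F (n ≡ᵇ n) n  ≡⟨ cong₂ _+_ (∑<-cong n below) (cong (λ b → F b n) (≡ᵇ-refl n)) ⟩
  (∑[ d < n ] F false d) + F true n        ∎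
  where
  open ≡-Reasoning
  below : ∀ d → d < n → F (d ≡ᵇ n) d ≡ F false d
  below d d<n = cong (λ b → F b d) (≢⇒≡ᵇ-false (<⇒≢ d<n))

∑<-when-≡ᵇ : ∀ h b n → b < n → ∑[ d < n ] when (d ≡ᵇ b) (h d) ≡ h b
∑<-when-≡ᵇ h zero    (suc n) _         = trans (cong (_+_ (h 0)) (∑<-zero n)) (+-identityʳ (h 0))
∑<-when-≡ᵇ h (suc b) (suc n) (s<s b<n) = trans (+-identityˡ _) (∑<-when-≡ᵇ (h ∘ suc) b n b<n)

∑<-when-≤ᵇ : ∀ h b n → b < n → ∑[ d < n ] when (d ≤ᵇ b) (h d) ≡ ∑< (suc b) h
∑<-when-≤ᵇ h zero    (suc n) _         = cong (_+_ (h 0)) (∑<-zero n)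
∑<-when-≤ᵇ h (suc b) (suc n) (s<s b<n) = cong (_+_ (h 0)) (begin
  ∑[ d < n ] when (suc d ≤ᵇ suc b) (h (suc d))
    ≡⟨ ∑<-cong n (λ d _ → cong (λ c → when c (h (suc d))) (suc-≤ᵇ-suc d b)) ⟩
  ∑[ d < n ] when (d ≤ᵇ b) (h (suc d))
    ≡⟨ ∑<-when-≤ᵇ (h ∘ suc) b n b<n ⟩
  ∑< (suc b) (h ∘ suc) ∎)
  where open ≡-Reasoning

sumℚ-++ : ∀ xs ys → sumℚ (xs ++ ys) ≡ sumℚ xs + sumℚ ys
sumℚ-++ []       ys = sym (+-identityˡ _)
sumℚ-++ (x ∷ xs) ys = trans (cong (_+_ x) (sumℚ-++ xs ys)) (sym (+-assoc x _ _))

module _ {A : Set} where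

  sum-map-*ˡ : ∀ c (f : A → ℚ) L → sumℚ (List.map (λ t → c * f t) L) ≡ c * sumℚ (List.map f L)
  sum-map-*ˡ c f []      = sym (*-zeroʳ c)
  sum-map-*ˡ c f (t ∷ L) =
    trans (cong (_+_ (c * f t)) (sum-map-*ˡ c f L)) (sym (*-distribˡ-+ c (f t) _))

  sum-map-when-∧ : ∀ x (p : A → Bool) (f : A → ℚ) L →
    sumℚ (List.map (λ t → when (x ∧ p t) (f t)) L)
    ≡ when x (sumℚ (List.map (λ t → when (p t) (f t)) L))
  sum-map-when-∧ true  p f L = refl
  sum-map-when-∧ false p f L = zeros L
    where
    zeros : ∀ L → sumℚ (List.map (λ _ → 0ℚ) L) ≡ 0ℚ
    zeros []      = refl
    zeros (_ ∷ L) = trans (+-identityˡ _) (zeros L)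

  sum-map-filterᵇ : ∀ (p : A → Bool) (f : A → ℚ) L →
    sumℚ (List.map f (filterᵇ p L)) ≡ sumℚ (List.map (λ t → when (p t) (f t)) L)
  sum-map-filterᵇ p f []      = refl
  sum-map-filterᵇ p f (t ∷ L) with p t
  ... | true  = cong (_+_ (f t)) (sum-map-filterᵇ p f L)
  ... | false = trans (sum-map-filterᵇ p f L) (sym (+-identityˡ _))

  sum-map-concatMap : ∀ {B : Set} (f : A → ℚ) (g : B → List A) L →
    sumℚ (List.map f (concatMap g L)) ≡ sumℚ (List.map (λ b → sumℚ (List.map f (g b))) L)
  sum-map-concatMap f g []      = refl
  sum-map-concatMap f g (b ∷ L) = begin
    sumℚ (List.map f (g b ++ concatMap g L))                 ≡⟨ cong sumℚ (map-++ f (g b) _) ⟩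
    sumℚ (List.map f (g b) ++ List.map f (concatMap g L))    ≡⟨ sumℚ-++ (List.map f (g b)) _ ⟩
    sumℚ (List.map f (g b)) + sumℚ (List.map f (concatMap g L))
      ≡⟨ cong (_+_ (sumℚ (List.map f (g b)))) (sum-map-concatMap f g L) ⟩
    sumℚ (List.map (λ b → sumℚ (List.map f (g b))) (b ∷ L))  ∎
    where open ≡-Reasoning

sum-map-applyUpTo : ∀ (f : ℕ → ℚ) g n → sumℚ (List.map f (applyUpTo g n)) ≡ ∑[ d < n ] f (g d)
sum-map-applyUpTo f g zero    = refl
sum-map-applyUpTo f g (suc n) = cong (_+_ (f (g 0))) (sum-map-applyUpTo f (g ∘ suc) n)

∑Ω : ∀ {n} → Vec ℕ n → (Vec ℕ n → ℚ) → ℚ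
∑Ω ν f = sumℚ (List.map f (Ωle ν))

∑Ω-cong : ∀ {n} (ν : Vec ℕ n) {f g : Vec ℕ n → ℚ} → (∀ t → f t ≡ g t) → ∑Ω ν f ≡ ∑Ω ν g
∑Ω-cong ν f≡g = cong sumℚ (map-cong f≡g (Ωle ν))

∑Ω-cons : ∀ {n} v (ν : Vec ℕ n) f → ∑Ω (v ∷ ν) f ≡ ∑[ d < suc v ] ∑Ω ν (λ t → f (d ∷ t))
∑Ω-cons v ν f = trans (sum-map-concatMap f (λ d → List.map (d ∷_) (Ωle ν)) (upTo (suc v)))
  (trans (cong sumℚ (map-cong (λ d → cong sumℚ (sym (map-∘ (Ωle ν)))) (upTo (suc v))))
         (sum-map-applyUpTo (λ d → ∑Ω ν (λ t → f (d ∷ t))) id (suc v)))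

∑Ω-allLe : ∀ {n} (ν : Vec ℕ n) f → ∑Ω ν (λ t → when (allLe t ν) (f t)) ≡ ∑Ω ν f
∑Ω-allLe []      f = refl
∑Ω-allLe (v ∷ ν) f = begin
  ∑Ω (v ∷ ν) (λ t → when (allLe t (v ∷ ν)) (f t))                     ≡⟨ ∑Ω-cons v ν _ ⟩
  ∑[ d < suc v ] ∑Ω ν (λ t → when ((d ≤ᵇ v) ∧ allLe t ν) (f (d ∷ t)))  ≡⟨ ∑<-cong (suc v) drop-≤ᵇ ⟩
  ∑[ d < suc v ] ∑Ω ν (λ t → f (d ∷ t))                               ≡⟨ ∑Ω-cons v ν f ⟨
  ∑Ω (v ∷ ν) f                                                        ∎
  where
  open ≡-Reasoning
  drop-≤ᵇ : ∀ d → d < suc v →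
    ∑Ω ν (λ t → when ((d ≤ᵇ v) ∧ allLe t ν) (f (d ∷ t))) ≡ ∑Ω ν (λ t → f (d ∷ t))
  drop-≤ᵇ d d<1+v rewrite Equivalence.to T-≡ (≤⇒≤ᵇ (≤-pred d<1+v)) = ∑Ω-allLe ν (λ t → f (d ∷ t))

iBox-refl : ∀ {n} (ν : Vec ℕ n) → iBox ν ν ≡ nothing
iBox-refl []      = refl
iBox-refl (v ∷ ν) rewrite iBox-refl ν | <ᵇ-irrefl v = refl

iBox-head : ∀ {n} {b v} (ν : Vec ℕ n) → b < v → iBox (b ∷ ν) (v ∷ ν) ≡ just zero
iBox-head ν b<v rewrite iBox-refl ν | Equivalence.to T-≡ (<⇒<ᵇ b<v) = refl

iBox-cons : ∀ {n} {b v} {s μ : Vec ℕ n} {j} → iBox s μ ≡ just j → iBox (b ∷ s) (v ∷ μ) ≡ just (suc j)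
iBox-cons {s = s} {μ} e rewrite e = refl

iBox-cons-inv : ∀ {n} {b v} {s μ : Vec ℕ n} {i} → iBox (b ∷ s) (v ∷ μ) ≡ just i →
  (∃ λ j → i ≡ suc j × iBox s μ ≡ just j) ⊎ (i ≡ zero × b < v × iBox s μ ≡ nothing)
iBox-cons-inv {b = b} {v} {s} {μ} e with iBox s μ
... | just j with refl ← e = inj₁ (j , refl , refl)
... | nothing with b <ᵇ v in b<ᵇv
...   | true with refl ← e = inj₂ (refl , <ᵇ⇒< b v (Equivalence.from T-≡ b<ᵇv) , refl)

iBox≡just-zero⇒< : ∀ {n} {b v} {s μ : Vec ℕ n} → iBox (b ∷ s) (v ∷ μ) ≡ just zero → b < v
iBox≡just-zero⇒< {s = s} {μ} e with iBox-cons-inv {s = s} {μ} e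
... | inj₂ (_ , b<v , _) = b<v

iBox≡nothing⇒≡ : ∀ {n} {s μ : Vec ℕ n} → Pointwise _≤_ s μ → iBox s μ ≡ nothing → s ≡ μ
iBox≡nothing⇒≡ [] _ = refl
iBox≡nothing⇒≡ {s = b ∷ s} {v ∷ μ} (b≤v ∷ s≤μ) e with iBox s μ in eq
... | nothing with b <ᵇ v in b<ᵇv
...   | false = cong₂ _∷_ (≤∧≮⇒≡ b≤v b≮v) (iBox≡nothing⇒≡ s≤μ eq)
  where
  b≮v : ¬ b < v
  b≮v b<v = subst T b<ᵇv (<⇒<ᵇ b<v)

inΩ-just : ∀ {n} (μ s : Vec ℕ n) {i} t → iBox s μ ≡ just i → inΩ μ s t ≡ agreeBelow i t s
inΩ-just μ s t e rewrite e = refl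

inΩ-nothing : ∀ {n} (μ s : Vec ℕ n) t → iBox s μ ≡ nothing → inΩ μ s t ≡ true
inΩ-nothing μ s t e rewrite e = refl

-- Either t₁ is pinned to b₁, or i_□ = 1 and t₁ ≤ b₁ < μ₁.
∈Ω⇒head-boxed≡ : ∀ {n} {μ s t : Vec ℕ (suc n)} {j} → iBox s μ ≡ just j → agreeBelow j t s ≡ true →
  (head t ≡ᵇ head μ) ≡ (head s ≡ᵇ head μ)
∈Ω⇒head-boxed≡ {μ = m ∷ _} {b ∷ _} {d ∷ _} {suc _} _ t∈Ω =
  cong (_≡ᵇ m) (≡ᵇ⇒≡ d b (∧-trueˡ t∈Ω))
∈Ω⇒head-boxed≡ {μ = m ∷ μ} {b ∷ s} {d ∷ _} {zero} e t∈Ω =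
  trans (≢⇒≡ᵇ-false (<⇒≢ (≤-<-trans (≤ᵇ⇒≤ d b (∧-trueˡ t∈Ω)) b<m))) (sym (≢⇒≡ᵇ-false (<⇒≢ b<m)))
  where b<m = iBox≡just-zero⇒< {s = s} {μ} e

GΔ-prefix-suc : ∀ {n} p b v (s μ : Vec ℕ (suc n)) j →
  GΔ p (prefix (suc j) (b ∷ s)) (prefix (suc j) (v ∷ μ))
  ≡ γ p (b ≡ᵇ 0) (b ≡ᵇ v) * γ p (b ≡ᵇ 0) (head s ≡ᵇ head μ) * GΔ p (prefix j s) (prefix j μ)
GΔ-prefix-suc p b v (_ ∷ _) (_ ∷ _) zero    = refl
GΔ-prefix-suc p b v (_ ∷ _) (_ ∷ _) (suc j) = refl

^ℕ-+ : ∀ p m n → p ^ℕ (m ℕ.+ n) ≡ p ^ℕ m * p ^ℕ n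
^ℕ-+ p zero    n = sym (*-identityˡ _)
^ℕ-+ p (suc m) n = trans (cong (p *_) (^ℕ-+ p m n)) (sym (*-assoc p _ _))

sumPred : ∀ {n} → Vec ℕ n → ℕ
sumPred []      = 0
sumPred (v ∷ ν) = (v ∸ 1) ℕ.+ sumPred ν

kA≡sumPred+length : ∀ {n} {ν : Vec ℕ n} → All (1 ≤_) ν → kA ν ≡ sumPred ν ℕ.+ n
kA≡sumPred+length                   []          = refl
kA≡sumPred+length {suc n} {suc w ∷ ν} (_ ∷ ν≥1) = begin
  suc w ℕ.+ kA ν                 ≡⟨ cong (λ k → suc w ℕ.+ k) (kA≡sumPred+length ν≥1) ⟩
  suc w ℕ.+ (sumPred ν ℕ.+ n)    ≡⟨ cong suc (+-assoc-ℕ w (sumPred ν) n) ⟨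
  suc (w ℕ.+ sumPred ν ℕ.+ n)    ≡⟨ +-suc (w ℕ.+ sumPred ν) n ⟨
  w ℕ.+ sumPred ν ℕ.+ suc n      ∎
  where open ≡-Reasoning

↥-fromℕ : ∀ n → ↥ fromℕ n ≡ + n
↥-fromℕ n = cong ↥_ (normalize-coprime {n} {0} (Coprime.sym (1-coprimeTo n)))

fromℕ-injective : ∀ {m n} → fromℕ m ≡ fromℕ n → m ≡ n
fromℕ-injective {m} {n} e = ℤ.+-injective (trans (sym (↥-fromℕ m)) (trans (cong ↥_ e) (↥-fromℕ n)))

*-inv : ∀ p → p ≢ 0ℚ → p * inv p ≡ 1ℚ
*-inv p p≢0 with p ≟ 0ℚ
... | yes p≡0  = ⊥-elim (p≢0 p≡0)
... | no  p≢0′ = *-inverseʳ p {{≢-nonZero p≢0′}}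

1-inv≢0 : ∀ {p} → p * inv p ≡ 1ℚ → p ≢ 1ℚ → 1ℚ - inv p ≢ 0ℚ
1-inv≢0 {p} p*p⁻¹≡1 p≢1 1-p⁻¹≡0 = p≢1 (begin
  p             ≡⟨ *-identityʳ p ⟨
  p * 1ℚ        ≡⟨ cong (p *_) p⁻¹≡1 ⟨
  p * inv p     ≡⟨ p*p⁻¹≡1 ⟩
  1ℚ            ∎)
  where
  open ≡-Reasoning
  p⁻¹≡1 : inv p ≡ 1ℚ
  p⁻¹≡1 = trans (solve 1 (λ x → x := con 1ℚ :- (con 1ℚ :- x)) refl (inv p)) (cong (1ℚ -_) 1-p⁻¹≡0)

+[m+n]-+n≡+m : ∀ m n → + (m ℕ.+ n) ℤ.- + n ≡ + m
+[m+n]-+n≡+m m n =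
  trans (ℤ.m-n≡m⊖n (m ℕ.+ n) n) (trans (ℤ.⊖-≥ (m≤n+m n m)) (cong +_ (m+n∸n≡m m n)))

module WeightSums (Q : ℚ) (Q*Q⁻¹≡1 : Q * inv Q ≡ 1ℚ)
                  (1-Q⁻¹-invertible : (1ℚ - inv Q) * inv (1ℚ - inv Q) ≡ 1ℚ) where

  Q⁻¹*Q* : ∀ p → inv Q * (Q * p) ≡ p
  Q⁻¹*Q* p = begin
    inv Q * (Q * p)  ≡⟨ *-assoc (inv Q) Q p ⟨
    inv Q * Q * p    ≡⟨ cong (_* p) (trans (*-comm (inv Q) Q) Q*Q⁻¹≡1) ⟩
    1ℚ * p           ≡⟨ *-identityˡ p ⟩
    p                ∎
    where open ≡-Reasoning

  γ-unboxed-* : ∀ p → γ Q false false * (Q * p) ≡ Q * p - p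
  γ-unboxed-* p = trans (solve 2 (λ x y → (con 1ℚ :- x) :* y := y :- x :* y) refl (inv Q) (Q * p))
                        (cong (Q * p -_) (Q⁻¹*Q* p))

  γ-boxed-* : ∀ p → γ Q false true * (Q * p) ≡ 0ℚ - p
  γ-boxed-* p = trans (solve 2 (λ x y → (con 0ℚ :- x) :* y := con 0ℚ :- x :* y) refl (inv Q) (Q * p))
                      (cong (0ℚ -_) (Q⁻¹*Q* p))

  ∑γ-unboxed : ∀ b → ∑[ d < suc b ] γ Q (d ≡ᵇ 0) false * Q ^ℕ d ≡ Q ^ℕ b
  ∑γ-unboxed zero    = refl
  ∑γ-unboxed (suc b) = begin
    ∑[ d < suc (suc b) ] γ Q (d ≡ᵇ 0) false * Q ^ℕ d
      ≡⟨ ∑<-snoc (λ d → γ Q (d ≡ᵇ 0) false * Q ^ℕ d) (suc b) ⟩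
    (∑[ d < suc b ] γ Q (d ≡ᵇ 0) false * Q ^ℕ d) + γ Q false false * (Q * Q ^ℕ b)
      ≡⟨ cong₂ _+_ (∑γ-unboxed b) (γ-unboxed-* (Q ^ℕ b)) ⟩
    Q ^ℕ b + (Q * Q ^ℕ b - Q ^ℕ b)
      ≡⟨ solve 2 (λ p p' → p :+ (p' :- p) := p') refl (Q ^ℕ b) (Q * Q ^ℕ b) ⟩
    Q * Q ^ℕ b ∎
    where open ≡-Reasoning

  entryWt : ℕ → ℕ → ℚ
  entryWt d v = γ Q (d ≡ᵇ 0) (d ≡ᵇ v) * Q ^ℕ d

  ∑entryWt≡0 : ∀ w → ∑[ d < suc (suc w) ] entryWt d (suc w) ≡ 0ℚ
  ∑entryWt≡0 w = begin
    ∑[ d < suc (suc w) ] entryWt d (suc w)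
      ≡⟨ ∑<-split-last (λ c d → γ Q (d ≡ᵇ 0) c * Q ^ℕ d) (suc w) ⟩
    (∑[ d < suc w ] γ Q (d ≡ᵇ 0) false * Q ^ℕ d) + γ Q false true * (Q * Q ^ℕ w)
      ≡⟨ cong₂ _+_ (∑γ-unboxed w) (γ-boxed-* (Q ^ℕ w)) ⟩
    Q ^ℕ w + (0ℚ - Q ^ℕ w)
      ≡⟨ solve 1 (λ p → p :+ (con 0ℚ :- p) := con 0ℚ) refl (Q ^ℕ w) ⟩
    0ℚ ∎
    where open ≡-Reasoning

  ∑linked-entryWt : ∀ c w → ∑[ d < suc (suc w) ] γ Q c (d ≡ᵇ suc w) * entryWt d (suc w) ≡ Q ^ℕ w
  ∑linked-entryWt c w = begin
    ∑[ d < suc (suc w) ] γ Q c (d ≡ᵇ suc w) * entryWt d (suc w)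
      ≡⟨ ∑<-split-last (λ b d → γ Q c b * (γ Q (d ≡ᵇ 0) b * Q ^ℕ d)) (suc w) ⟩
    (∑[ d < suc w ] γ Q c false * (γ Q (d ≡ᵇ 0) false * Q ^ℕ d))
      + γ Q c true * (γ Q false true * (Q * Q ^ℕ w))
      ≡⟨ cong₂ _+_ (trans (∑<-*ˡ (γ Q c false) (λ d → γ Q (d ≡ᵇ 0) false * Q ^ℕ d) (suc w))
                          (cong (γ Q c false *_) (∑γ-unboxed w)))
                   (cong (γ Q c true *_) (γ-boxed-* (Q ^ℕ w))) ⟩
    γ Q c false * Q ^ℕ w + γ Q c true * (0ℚ - Q ^ℕ w)
      ≡⟨ closing c ⟩
    Q ^ℕ w ∎
    where
    open ≡-Reasoning
    closing : ∀ c → γ Q c false * Q ^ℕ w + γ Q c true * (0ℚ - Q ^ℕ w) ≡ Q ^ℕ w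
    closing true  = solve 1 (λ p → con 1ℚ :* p :+ con 0ℚ :* (con 0ℚ :- p) := p) refl (Q ^ℕ w)
    closing false =
      solve 2 (λ x p → (con 1ℚ :- x) :* p :+ (con 0ℚ :- x) :* (con 0ℚ :- p) := p) refl (inv Q) (Q ^ℕ w)

  -- GΔ t ν together with the factor γ(c, t₁ = ν₁) that links t to a preceding entry circled iff c;
  -- it is what remains of GΔ (d ∷ t) after the factor of the entry d itself.
  GΔ-linked : ∀ {n} → Bool → Vec ℕ n → Vec ℕ n → ℚ
  GΔ-linked c []      []      = 1ℚ
  GΔ-linked c (d ∷ t) (v ∷ ν) = γ Q c (d ≡ᵇ v) * GΔ Q (d ∷ t) (v ∷ ν)

  GΔ-cons : ∀ {n} d v (t ν : Vec ℕ n) →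
    GΔ Q (d ∷ t) (v ∷ ν) ≡ γ Q (d ≡ᵇ 0) (d ≡ᵇ v) * GΔ-linked (d ≡ᵇ 0) t ν
  GΔ-cons d v []       []       = sym (*-identityʳ _)
  GΔ-cons d v (d' ∷ t) (v' ∷ ν) =
    *-assoc (γ Q (d ≡ᵇ 0) (d ≡ᵇ v)) (γ Q (d ≡ᵇ 0) (d' ≡ᵇ v')) (GΔ Q (d' ∷ t) (v' ∷ ν))

  Wt : ∀ {n} → Vec ℕ n → Vec ℕ n → ℚ
  Wt ν t = GΔ Q t ν * Q ^ℕ kA t

  Wt-linked : ∀ {n} → Bool → Vec ℕ n → Vec ℕ n → ℚ
  Wt-linked c ν t = GΔ-linked c t ν * Q ^ℕ kA t

  Wt-cons : ∀ {n} d v (t ν : Vec ℕ n) → Wt (v ∷ ν) (d ∷ t) ≡ entryWt d v * Wt-linked (d ≡ᵇ 0) ν t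
  Wt-cons d v t ν =
    trans (cong₂ _*_ (GΔ-cons d v t ν) (^ℕ-+ Q d (kA t)))
          (interchange (γ Q (d ≡ᵇ 0) (d ≡ᵇ v)) (GΔ-linked (d ≡ᵇ 0) t ν) (Q ^ℕ d) (Q ^ℕ kA t))

  ∑Ω-Wt-cons : ∀ {n} d v (ν : Vec ℕ n) →
    ∑Ω ν (λ t → Wt (v ∷ ν) (d ∷ t)) ≡ entryWt d v * ∑Ω ν (Wt-linked (d ≡ᵇ 0) ν)
  ∑Ω-Wt-cons d v ν =
    trans (∑Ω-cong ν (λ t → Wt-cons d v t ν)) (sum-map-*ˡ (entryWt d v) (Wt-linked (d ≡ᵇ 0) ν) (Ωle ν))

  ∑Ω-Wt-linked : ∀ {n} {ν : Vec ℕ n} → All (1 ≤_) ν → ∀ c → ∑Ω ν (Wt-linked c ν) ≡ Q ^ℕ sumPred ν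
  ∑Ω-Wt-fixed-head : ∀ {n} d v {ν : Vec ℕ n} → All (1 ≤_) ν →
    ∑Ω ν (λ t → Wt (v ∷ ν) (d ∷ t)) ≡ entryWt d v * Q ^ℕ sumPred ν

  ∑Ω-Wt-linked []                        c = refl
  ∑Ω-Wt-linked {ν = suc w ∷ ν} (_ ∷ ν≥1) c = begin
    ∑Ω (suc w ∷ ν) (Wt-linked c (suc w ∷ ν))
      ≡⟨ ∑Ω-cons (suc w) ν (Wt-linked c (suc w ∷ ν)) ⟩
    ∑[ d < suc (suc w) ] ∑Ω ν (λ t → Wt-linked c (suc w ∷ ν) (d ∷ t))
      ≡⟨ ∑<-cong (suc (suc w)) (λ d _ → pull-link d) ⟩
    ∑[ d < suc (suc w) ] γ Q c (d ≡ᵇ suc w) * (entryWt d (suc w) * Q ^ℕ sumPred ν)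
      ≡⟨ ∑<-cong (suc (suc w))
                 (λ d _ → *-assoc (γ Q c (d ≡ᵇ suc w)) (entryWt d (suc w)) (Q ^ℕ sumPred ν)) ⟨
    ∑[ d < suc (suc w) ] γ Q c (d ≡ᵇ suc w) * entryWt d (suc w) * Q ^ℕ sumPred ν
      ≡⟨ ∑<-*ʳ (λ d → γ Q c (d ≡ᵇ suc w) * entryWt d (suc w)) (Q ^ℕ sumPred ν) (suc (suc w)) ⟩
    (∑[ d < suc (suc w) ] γ Q c (d ≡ᵇ suc w) * entryWt d (suc w)) * Q ^ℕ sumPred ν
      ≡⟨ cong (_* Q ^ℕ sumPred ν) (∑linked-entryWt c w) ⟩
    Q ^ℕ w * Q ^ℕ sumPred ν
      ≡⟨ ^ℕ-+ Q w (sumPred ν) ⟨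
    Q ^ℕ sumPred (suc w ∷ ν) ∎
    where
    open ≡-Reasoning
    pull-link : ∀ d → ∑Ω ν (λ t → Wt-linked c (suc w ∷ ν) (d ∷ t))
                      ≡ γ Q c (d ≡ᵇ suc w) * (entryWt d (suc w) * Q ^ℕ sumPred ν)
    pull-link d = begin
      ∑Ω ν (λ t → Wt-linked c (suc w ∷ ν) (d ∷ t))
        ≡⟨ ∑Ω-cong ν (λ t → *-assoc (γ Q c (d ≡ᵇ suc w)) (GΔ Q (d ∷ t) (suc w ∷ ν)) (Q ^ℕ kA (d ∷ t))) ⟩
      ∑Ω ν (λ t → γ Q c (d ≡ᵇ suc w) * Wt (suc w ∷ ν) (d ∷ t))
        ≡⟨ sum-map-*ˡ (γ Q c (d ≡ᵇ suc w)) (λ t → Wt (suc w ∷ ν) (d ∷ t)) (Ωle ν) ⟩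
      γ Q c (d ≡ᵇ suc w) * ∑Ω ν (λ t → Wt (suc w ∷ ν) (d ∷ t))
        ≡⟨ cong (γ Q c (d ≡ᵇ suc w) *_) (∑Ω-Wt-fixed-head d (suc w) ν≥1) ⟩
      γ Q c (d ≡ᵇ suc w) * (entryWt d (suc w) * Q ^ℕ sumPred ν) ∎

  ∑Ω-Wt-fixed-head d v {ν} ν≥1 =
    trans (∑Ω-Wt-cons d v ν) (cong (entryWt d v *_) (∑Ω-Wt-linked ν≥1 (d ≡ᵇ 0)))

  ∑Ω-Wt≡0 : ∀ {n} {ν : Vec ℕ (suc n)} → All (1 ≤_) ν → ∑Ω ν (Wt ν) ≡ 0ℚ
  ∑Ω-Wt≡0 {ν = suc w ∷ ν} (_ ∷ ν≥1) = begin
    ∑Ω (suc w ∷ ν) (Wt (suc w ∷ ν))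
      ≡⟨ ∑Ω-cons (suc w) ν (Wt (suc w ∷ ν)) ⟩
    ∑[ d < suc (suc w) ] ∑Ω ν (λ t → Wt (suc w ∷ ν) (d ∷ t))
      ≡⟨ ∑<-cong (suc (suc w)) (λ d _ → ∑Ω-Wt-fixed-head d (suc w) ν≥1) ⟩
    ∑[ d < suc (suc w) ] entryWt d (suc w) * Q ^ℕ sumPred ν
      ≡⟨ ∑<-*ʳ (λ d → entryWt d (suc w)) (Q ^ℕ sumPred ν) (suc (suc w)) ⟩
    (∑[ d < suc (suc w) ] entryWt d (suc w)) * Q ^ℕ sumPred ν
      ≡⟨ cong (_* Q ^ℕ sumPred ν) (∑entryWt≡0 w) ⟩
    0ℚ * Q ^ℕ sumPred ν
      ≡⟨ *-zeroˡ (Q ^ℕ sumPred ν) ⟩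
    0ℚ ∎
    where open ≡-Reasoning

  sumΩ : ∀ {n} → Vec ℕ n → Vec ℕ n → ℚ
  sumΩ μ s = ∑Ω μ (λ t → when (inΩ μ s t) (Wt μ t))

  sumΩ-maximal : ∀ {n} {μ : Vec ℕ (suc n)} → All (1 ≤_) μ → sumΩ μ μ ≡ 0ℚ
  sumΩ-maximal {μ = μ} μ≥1 =
    trans (∑Ω-cong μ (λ t → cong (λ c → when c (Wt μ t)) (inΩ-nothing μ μ t (iBox-refl μ)))) (∑Ω-Wt≡0 μ≥1)

  sumΩ-head : ∀ {n} {b v} {μ : Vec ℕ n} → b < v → All (1 ≤_) μ →
    sumΩ (v ∷ μ) (b ∷ μ) ≡ Q ^ℕ (b ℕ.+ sumPred μ)
  sumΩ-head {b = b} {v} {μ} b<v μ≥1 = begin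
    sumΩ (v ∷ μ) (b ∷ μ)
      ≡⟨ ∑Ω-cons v μ _ ⟩
    ∑[ d < suc v ] ∑Ω μ (λ t → when (inΩ (v ∷ μ) (b ∷ μ) (d ∷ t)) (Wt (v ∷ μ) (d ∷ t)))
      ≡⟨ ∑<-cong (suc v) (λ d _ → restrict d) ⟩
    ∑[ d < suc v ] when (d ≤ᵇ b) (∑Ω μ (λ t → Wt (v ∷ μ) (d ∷ t)))
      ≡⟨ ∑<-when-≤ᵇ (λ d → ∑Ω μ (λ t → Wt (v ∷ μ) (d ∷ t))) b (suc v) (m<n⇒m<1+n b<v) ⟩
    ∑[ d < suc b ] ∑Ω μ (λ t → Wt (v ∷ μ) (d ∷ t))
      ≡⟨ ∑<-cong (suc b) unboxed ⟩
    ∑[ d < suc b ] γ Q (d ≡ᵇ 0) false * Q ^ℕ d * Q ^ℕ sumPred μ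
      ≡⟨ ∑<-*ʳ (λ d → γ Q (d ≡ᵇ 0) false * Q ^ℕ d) (Q ^ℕ sumPred μ) (suc b) ⟩
    (∑[ d < suc b ] γ Q (d ≡ᵇ 0) false * Q ^ℕ d) * Q ^ℕ sumPred μ
      ≡⟨ cong (_* Q ^ℕ sumPred μ) (∑γ-unboxed b) ⟩
    Q ^ℕ b * Q ^ℕ sumPred μ
      ≡⟨ ^ℕ-+ Q b (sumPred μ) ⟨
    Q ^ℕ (b ℕ.+ sumPred μ) ∎
    where
    open ≡-Reasoning
    restrict : ∀ d → ∑Ω μ (λ t → when (inΩ (v ∷ μ) (b ∷ μ) (d ∷ t)) (Wt (v ∷ μ) (d ∷ t)))
                     ≡ when (d ≤ᵇ b) (∑Ω μ (λ t → Wt (v ∷ μ) (d ∷ t)))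
    restrict d =
      trans (∑Ω-cong μ (λ t → cong (λ c → when c (Wt (v ∷ μ) (d ∷ t)))
                                   (inΩ-just (v ∷ μ) (b ∷ μ) (d ∷ t) (iBox-head μ b<v))))
      (trans (sum-map-when-∧ (d ≤ᵇ b) (λ t → allLe t μ) (λ t → Wt (v ∷ μ) (d ∷ t)) (Ωle μ))
             (cong (when (d ≤ᵇ b)) (∑Ω-allLe μ (λ t → Wt (v ∷ μ) (d ∷ t)))))
    unboxed : ∀ d → d < suc b →
      ∑Ω μ (λ t → Wt (v ∷ μ) (d ∷ t)) ≡ γ Q (d ≡ᵇ 0) false * Q ^ℕ d * Q ^ℕ sumPred μ
    unboxed d d≤b = trans (∑Ω-Wt-fixed-head d v μ≥1)
      (cong (λ c → γ Q (d ≡ᵇ 0) c * Q ^ℕ d * Q ^ℕ sumPred μ)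
            (≢⇒≡ᵇ-false (<⇒≢ (≤-<-trans (≤-pred d≤b) b<v))))

  Wt-cons-∈Ω : ∀ {n} {b v} {μ s t : Vec ℕ (suc n)} {j} → iBox s μ ≡ just j → agreeBelow j t s ≡ true →
    Wt (v ∷ μ) (b ∷ t) ≡ entryWt b v * γ Q (b ≡ᵇ 0) (head s ≡ᵇ head μ) * Wt μ t
  Wt-cons-∈Ω {b = b} {v} {m ∷ μ} {s} {d ∷ t} e t∈Ω = begin
    Wt (v ∷ m ∷ μ) (b ∷ d ∷ t)
      ≡⟨ Wt-cons b v (d ∷ t) (m ∷ μ) ⟩
    entryWt b v * (γ Q (b ≡ᵇ 0) (d ≡ᵇ m) * G * P)
      ≡⟨ cong (λ c → entryWt b v * (γ Q (b ≡ᵇ 0) c * G * P)) (∈Ω⇒head-boxed≡ e t∈Ω) ⟩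
    entryWt b v * (γ Q (b ≡ᵇ 0) (head s ≡ᵇ m) * G * P)
      ≡⟨ solve 4 (λ a g x y → a :* (g :* x :* y) := a :* g :* (x :* y)) refl
           (entryWt b v) (γ Q (b ≡ᵇ 0) (head s ≡ᵇ m)) G P ⟩
    entryWt b v * γ Q (b ≡ᵇ 0) (head s ≡ᵇ m) * Wt (m ∷ μ) (d ∷ t) ∎
    where
    open ≡-Reasoning
    G = GΔ Q (d ∷ t) (m ∷ μ)
    P = Q ^ℕ kA (d ∷ t)

  sumΩ-cons : ∀ {n} {b v} {μ s : Vec ℕ (suc n)} {j} → b ≤ v → iBox s μ ≡ just j →
    sumΩ (v ∷ μ) (b ∷ s) ≡ entryWt b v * γ Q (b ≡ᵇ 0) (head s ≡ᵇ head μ) * sumΩ μ s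
  sumΩ-cons {b = b} {v} {μ} {s} {j} b≤v e = begin
    sumΩ (v ∷ μ) (b ∷ s)
      ≡⟨ ∑Ω-cons v μ _ ⟩
    ∑[ d < suc v ] ∑Ω μ (λ t → when (inΩ (v ∷ μ) (b ∷ s) (d ∷ t)) (Wt (v ∷ μ) (d ∷ t)))
      ≡⟨ ∑<-cong (suc v) (λ d _ → restrict d) ⟩
    ∑[ d < suc v ] when (d ≡ᵇ b) (∑Ω μ (λ t → when (agreeBelow j t s) (Wt (v ∷ μ) (d ∷ t))))
      ≡⟨ ∑<-when-≡ᵇ (λ d → ∑Ω μ (λ t → when (agreeBelow j t s) (Wt (v ∷ μ) (d ∷ t))))
                    b (suc v) (s≤s b≤v) ⟩
    ∑Ω μ (λ t → when (agreeBelow j t s) (Wt (v ∷ μ) (b ∷ t)))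
      ≡⟨ ∑Ω-cong μ pointwise ⟩
    ∑Ω μ (λ t → c * when (inΩ μ s t) (Wt μ t))
      ≡⟨ sum-map-*ˡ c (λ t → when (inΩ μ s t) (Wt μ t)) (Ωle μ) ⟩
    c * sumΩ μ s ∎
    where
    open ≡-Reasoning
    c = entryWt b v * γ Q (b ≡ᵇ 0) (head s ≡ᵇ head μ)
    restrict : ∀ d → ∑Ω μ (λ t → when (inΩ (v ∷ μ) (b ∷ s) (d ∷ t)) (Wt (v ∷ μ) (d ∷ t)))
                     ≡ when (d ≡ᵇ b) (∑Ω μ (λ t → when (agreeBelow j t s) (Wt (v ∷ μ) (d ∷ t))))
    restrict d =
      trans (∑Ω-cong μ (λ t → cong (λ x → when x (Wt (v ∷ μ) (d ∷ t)))
                                   (inΩ-just (v ∷ μ) (b ∷ s) (d ∷ t) (iBox-cons {b = b} {v} {s} {μ} e))))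
            (sum-map-when-∧ (d ≡ᵇ b) (λ t → agreeBelow j t s) (λ t → Wt (v ∷ μ) (d ∷ t)) (Ωle μ))
    pointwise : ∀ t → when (agreeBelow j t s) (Wt (v ∷ μ) (b ∷ t)) ≡ c * when (inΩ μ s t) (Wt μ t)
    pointwise t = trans (on-Ω t) (cong (λ x → c * when x (Wt μ t)) (sym (inΩ-just μ s t e)))
      where
      on-Ω : ∀ t → when (agreeBelow j t s) (Wt (v ∷ μ) (b ∷ t)) ≡ c * when (agreeBelow j t s) (Wt μ t)
      on-Ω t with agreeBelow j t s in t∈Ω
      ... | true  = Wt-cons-∈Ω e t∈Ω
      ... | false = sym (*-zeroʳ c)

  γ-unboxed-if0 : ∀ {b v} → b < v → γ Q (b ≡ᵇ 0) (b ≡ᵇ v) * if0 b (inv (1ℚ - inv Q)) ≡ 1ℚ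
  γ-unboxed-if0 {zero}  {suc v} _   = refl
  γ-unboxed-if0 {suc b} {v}     b<v rewrite ≢⇒≡ᵇ-false (<⇒≢ b<v) = 1-Q⁻¹-invertible

  -- k is the exponent k_A(s) − (r − i_□) of the paper, a natural number.
  ClosedForm : ∀ {n} → Vec ℕ n → Vec ℕ n → Fin n → Set
  ClosedForm {n} μ s i = ∃ λ k → kA s ≡ k ℕ.+ (n ∸ suc (toℕ i)) ×
    sumΩ μ s ≡ Q ^ℕ k * GΔ Q (prefix i s) (prefix i μ) * if0 (lookup s i) (inv (1ℚ - inv Q))

  closedForm-head : ∀ {n} {b v} {μ : Vec ℕ n} → b < v → All (1 ≤_) μ → ClosedForm (v ∷ μ) (b ∷ μ) zero
  closedForm-head {n} {b} {v} {μ} b<v μ≥1 =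
    b ℕ.+ sumPred μ ,
    trans (cong (b ℕ.+_) (kA≡sumPred+length μ≥1)) (sym (+-assoc-ℕ b (sumPred μ) n)) ,
    (begin
      sumΩ (v ∷ μ) (b ∷ μ)                ≡⟨ sumΩ-head b<v μ≥1 ⟩
      P                                    ≡⟨ *-identityʳ P ⟨
      P * 1ℚ                               ≡⟨ cong (P *_) (γ-unboxed-if0 b<v) ⟨
      P * (γ Q (b ≡ᵇ 0) (b ≡ᵇ v) * F)      ≡⟨ *-assoc P (γ Q (b ≡ᵇ 0) (b ≡ᵇ v)) F ⟨
      P * γ Q (b ≡ᵇ 0) (b ≡ᵇ v) * F        ∎)
    where
    open ≡-Reasoning
    P = Q ^ℕ (b ℕ.+ sumPred μ)
    F = if0 b (inv (1ℚ - inv Q))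

  closedForm-cons : ∀ {n} {b v} {μ s : Vec ℕ n} {j} → b ≤ v → iBox s μ ≡ just j →
    ClosedForm μ s j → ClosedForm (v ∷ μ) (b ∷ s) (suc j)
  closedForm-cons {μ = []} {[]} _ () _
  closedForm-cons {b = b} {v} {m ∷ μ} {s₁ ∷ s} {j} b≤v e (k , kA≡ , sum≡) =
    b ℕ.+ k ,
    trans (cong (b ℕ.+_) kA≡) (sym (+-assoc-ℕ b k _)) ,
    (begin
      sumΩ (v ∷ m ∷ μ) (b ∷ s₁ ∷ s)
        ≡⟨ sumΩ-cons {μ = m ∷ μ} {s₁ ∷ s} b≤v e ⟩
      entryWt b v * g * sumΩ (m ∷ μ) (s₁ ∷ s)
        ≡⟨ cong (entryWt b v * g *_) sum≡ ⟩
      entryWt b v * g * (Q ^ℕ k * G * F)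
        ≡⟨ solve 6 (λ γ₀ x g y G F → γ₀ :* x :* g :* (y :* G :* F) := x :* y :* (γ₀ :* g :* G) :* F) refl
             (γ Q (b ≡ᵇ 0) (b ≡ᵇ v)) (Q ^ℕ b) g (Q ^ℕ k) G F ⟩
      Q ^ℕ b * Q ^ℕ k * (γ Q (b ≡ᵇ 0) (b ≡ᵇ v) * g * G) * F
        ≡⟨ cong₂ (λ x y → x * y * F) (^ℕ-+ Q b k) (GΔ-prefix-suc Q b v (s₁ ∷ s) (m ∷ μ) j) ⟨
      Q ^ℕ (b ℕ.+ k) * GΔ Q (prefix (suc j) (b ∷ s₁ ∷ s)) (prefix (suc j) (v ∷ m ∷ μ)) * F ∎)
    where
    open ≡-Reasoning
    g = γ Q (b ≡ᵇ 0) (s₁ ≡ᵇ m)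
    G = GΔ Q (prefix j (s₁ ∷ s)) (prefix j (m ∷ μ))
    F = if0 (lookup (s₁ ∷ s) j) (inv (1ℚ - inv Q))

  closedForm : ∀ {n} {μ s : Vec ℕ n} {i} → All (1 ≤_) μ → Pointwise _≤_ s μ → iBox s μ ≡ just i →
    ClosedForm μ s i
  closedForm {μ = v ∷ μ} {b ∷ s} (_ ∷ μ≥1) (b≤v ∷ s≤μ) e with iBox-cons-inv {s = s} {μ} e
  ... | inj₁ (j , refl , eq) = closedForm-cons b≤v eq (closedForm μ≥1 s≤μ eq)
  ... | inj₂ (refl , b<v , eq) with refl ← iBox≡nothing⇒≡ s≤μ eq = closedForm-head b<v μ≥1

  closedForm-ℤ : ∀ {n} {μ s : Vec ℕ n} {i} → ClosedForm μ s i →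
    sumΩ μ s ≡ Q ^ℤ (+ kA s ℤ.- + (n ∸ suc (toℕ i)))
               * GΔ Q (prefix i s) (prefix i μ) * if0 (lookup s i) (inv (1ℚ - inv Q))
  closedForm-ℤ {n} {μ} {s} {i} (k , kA≡ , sumΩ≡) = trans sumΩ≡
    (cong (λ z → Q ^ℤ z * GΔ Q (prefix i s) (prefix i μ) * if0 (lookup s i) (inv (1ℚ - inv Q)))
          (sym (trans (cong (λ a → + a ℤ.- + (n ∸ suc (toℕ i))) kA≡)
                      (+[m+n]-+n≡+m k (n ∸ suc (toℕ i))))))

  closedForm-nonmaximal : ∀ {n} {μ s : Vec ℕ n} → All (1 ≤_) μ → Pointwise _≤_ s μ → ¬ s ≡ μ →
    ∃ λ i → iBox s μ ≡ just i × ClosedForm μ s i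
  closedForm-nonmaximal {μ = μ} {s} μ≥1 s≤μ s≢μ = by-iBox (iBox s μ) refl
    where
    by-iBox : ∀ m → iBox s μ ≡ m → ∃ λ i → iBox s μ ≡ just i × ClosedForm μ s i
    by-iBox nothing  eq = ⊥-elim (s≢μ (iBox≡nothing⇒≡ s≤μ eq))
    by-iBox (just i) eq = i , eq , closedForm μ≥1 s≤μ eq

lemma2 : (r : ℕ) → 1 ≤ r → (μ : Vec ℕ r) → All (λ m → 1 ≤ m) μ →
    (q : ℕ) → Prime q → (s : Vec ℕ r) → Pointwise _≤_ s μ →
    (s ≡ μ → LHS q μ s ≡ 0ℚ) ×
    (¬ (s ≡ μ) → ∃ λ (i : Fin r) → iBox s μ ≡ just i ×
      (LHS q μ s ≡
        (fromℕ q ^ℤ (+ kA s ℤ.- + (r ∸ suc (toℕ i))))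
        * GΔ (fromℕ q) (prefix i s) (prefix i μ)
        * (if0 (lookup s i) (inv (1ℚ - inv (fromℕ q))))))
lemma2 (suc r) _ μ μ≥1 q q-prime s s≤μ =
  (λ { refl → trans LHS≡sumΩ (sumΩ-maximal μ≥1) }) ,
  (λ s≢μ → let i , iBox≡i , closed = closedForm-nonmaximal μ≥1 s≤μ s≢μ
           in i , iBox≡i , trans LHS≡sumΩ (closedForm-ℤ {μ = μ} {s} closed))
  where
  Q : ℚ
  Q = fromℕ q
  q>1 : 1 < q
  q>1 = nonTrivial⇒n>1 q {{prime⇒nonTrivial q-prime}}
  Q*Q⁻¹≡1 : Q * inv Q ≡ 1ℚ
  Q*Q⁻¹≡1 = *-inv Q (λ Q≡0 → >⇒≢ (<-trans z<s q>1) (fromℕ-injective Q≡0))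
  1-Q⁻¹≢0 : 1ℚ - inv Q ≢ 0ℚ
  1-Q⁻¹≢0 = 1-inv≢0 Q*Q⁻¹≡1 (λ Q≡1 → >⇒≢ q>1 (fromℕ-injective Q≡1))
  open WeightSums Q Q*Q⁻¹≡1 (*-inv (1ℚ - inv Q) 1-Q⁻¹≢0)

  LHS≡sumΩ : LHS q μ s ≡ sumΩ μ s
  LHS≡sumΩ = sum-map-filterᵇ (inΩ μ s) (Wt μ) (Ωle μ)
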